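{- If $\Gamma$ is a connected mutation-finite graph with at least $4$ vertices, then $\Gamma$ does not contain $\mathbf{Z}_3$ as a (full) subgraph.
   Context: A graph here is a finite directed multigraph without loops and without oriented 2-cycles. For a vertex $k$ of such a graph $\Gamma$, the mutation $\mu_k\Gamma$ is obtained as follows: for every arrow $i\to k$ and every arrow $k\to j$ add a new arrow $i\to j$; then reverse every arrow starting or ending at $k$; finally remove pairs of opposite arrows (2-cycles) until none remain. $\Gamma$ is mutation-finite if only finitely many isomorphism classes of graphs are obtained from $\Gamma$ by sequences of mutations. A subgraph always means a full subgraph: for any two of its vertices it contains all arrows of $\Gamma$ between them. $\mathbf{Z}_3$ is the graph with vertices $x_1,x_2,x_3$ and exactly two arrows $x_1\to x_2$, two arrows $x_2\to x_3$, two arrows $x_3\to x_1$. -}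

module Defs where

open import Data.Nat using (ℕ; zero; suc; _+_; _*_; _∸_; _≤_)
open import Data.Fin using (Fin; zero; suc; _≟_)
open import Data.List using (List; []; _∷_)
open import Data.List.Relation.Unary.Any using (Any)
open import Data.Product using (Σ; ∃; _×_; _,_)
open import Data.Sum using (_⊎_)
open import Relation.Binary.PropositionalEquality using (_≡_; _≢_)
open import Relation.Nullary using (yes; no)
open import Function.Definitions using (Injective)

-- A (multi)graph on the vertex set Fin n: arrows i j = number of arrows i → j.
Graph : ℕ → Set
Graph n = Fin n → Fin n → ℕ

IsGraph : ∀ {n} → Graph n → Set
IsGraph {n} Γ = (∀ i → Γ i i ≡ 0) × (∀ i j → Γ i j ≡ 0 ⊎ Γ j i ≡ 0)

-- For i, j ≠ k: after adding the composite arrows there are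
-- Γ i j + Γ i k * Γ k j arrows i → j and Γ j i + Γ j k * Γ k i arrows j → i;
-- removing 2-cycles leaves the truncated difference.
mutate : ∀ {n} → Fin n → Graph n → Graph n
mutate k Γ i j with i ≟ k | j ≟ k
... | yes _ | _     = Γ j i
... | no _  | yes _ = Γ j i
... | no _  | no _  = (Γ i j + Γ i k * Γ k j) ∸ (Γ j i + Γ j k * Γ k i)

mutateSeq : ∀ {n} → List (Fin n) → Graph n → Graph n
mutateSeq []       Γ = Γ
mutateSeq (k ∷ ks) Γ = mutateSeq ks (mutate k Γ)

Iso : ∀ {n} → Graph n → Graph n → Set
Iso {n} Γ Δ = Σ (Fin n → Fin n) λ σ → Σ (Fin n → Fin n) λ τ →
  (∀ i → τ (σ i) ≡ i) × (∀ i → σ (τ i) ≡ i) × (∀ i j → Δ (σ i) (σ j) ≡ Γ i j)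

MutationFinite : ∀ {n} → Graph n → Set
MutationFinite {n} Γ = Σ (List (Graph n)) λ L →
  ∀ (ks : List (Fin n)) → Any (λ Δ → Iso (mutateSeq ks Γ) Δ) L

Adjacent : ∀ {n} → Graph n → Fin n → Fin n → Set
Adjacent Γ i j = (1 ≤ Γ i j) ⊎ (1 ≤ Γ j i)

data Reach {n} (Γ : Graph n) : Fin n → Fin n → Set where
  here : ∀ {i} → Reach Γ i i
  step : ∀ {i j k} → Adjacent Γ i j → Reach Γ j k → Reach Γ i k

Connected : ∀ {n} → Graph n → Set
Connected {n} Γ = ∀ (i j : Fin n) → Reach Γ i j

Z3 : Graph 3
Z3 zero             (suc zero)       = 2
Z3 (suc zero)       (suc (suc zero)) = 2
Z3 (suc (suc zero)) zero             = 2
Z3 _                _                = 0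

ContainsZ3 : ∀ {n} → Graph n → Set
ContainsZ3 {n} Γ = Σ (Fin 3 → Fin n) λ f →
  Injective _≡_ _≡_ f × (∀ a b → Γ (f a) (f b) ≡ Z3 a b)

module Submission where

-- If Γ contains Z₃ on vertices k, s, t (double arrows
-- k → s → t → k) and has at least four vertices, connectivity yields a
-- vertex y outside the triangle adjacent to one of its corners.  We show
-- that then the arrow multiplicities along mutation sequences are
-- unbounded, which is impossible for a mutation-finite graph (a finite list
-- of isomorphism classes bounds all multiplicities).
--
-- The engine is a "pumping" configuration: a double arrow k ⇉ j and a
-- vertex y with no arrow k → y and fewer arrows j → y than arrows from y to
-- {k, j}.  Mutating at k reproduces the configuration with k and j
-- exchanged and strictly increases the number of arrows leaving y
-- towards the double arrow, so alternating mutations at k and j pump it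
-- up without bound.  Reversing all arrows commutes with mutation, so every
-- argument also applies to the opposite graph; a short case analysis on the
-- arrows between y and the triangle then always finds a pumping
-- configuration in Γ or in its opposite.

open import Defs
open import Data.Nat using (ℕ; zero; suc; _+_; _*_; _∸_; _≤_; _<_; _⊔_; z≤n; s≤s; _<?_)
open import Data.Nat.Properties hiding (_≟_)
open import Data.Fin using (Fin; _≟_)
open import Data.Fin.Properties using (injective⇒≤; any?; all?; ¬∀⟶∃¬)
open import Data.List using (List; []; _∷_)
open import Data.List.Relation.Unary.All as All using (All; []; _∷_)
open import Data.Product using (∃; _×_; _,_; proj₁; proj₂)
open import Data.Sum using (_⊎_; inj₁; inj₂; [_,_])
open import Data.Empty using (⊥-elim)
open import Relation.Binary.PropositionalEquality using (_≡_; _≢_; refl; sym; ≢-sym; trans; cong; cong₂; subst; module ≡-Reasoning)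
open import Relation.Nullary using (¬_; yes; no)
open import Relation.Unary using (Decidable)
open import Function.Definitions using (Injective)
open import Data.Nat.Tactic.RingSolver using (solve-∀)

BoundedBy : ∀ {n} → ℕ → Graph n → Set
BoundedBy {n} B Γ = ∀ (ks : List (Fin n)) u v → mutateSeq ks Γ u v ≤ B

Bounded : ∀ {n} → Graph n → Set
Bounded Γ = ∃ λ B → BoundedBy B Γ

boundedBy-mutate : ∀ {n} {B} {Γ : Graph n} k → BoundedBy B Γ → BoundedBy B (mutate k Γ)
boundedBy-mutate k bound ks = bound (k ∷ ks)

finite-bound : ∀ {n} (f : Fin n → ℕ) → ∃ λ B → ∀ i → f i ≤ B
finite-bound {zero}  f = 0 , λ ()
finite-bound {suc n} f with finite-bound (λ i → f (Fin.suc i))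
... | B , below = f Fin.zero ⊔ B , λ where
  Fin.zero    → m≤m⊔n _ _
  (Fin.suc i) → ≤-trans (below i) (m≤n⊔m _ _)

EntriesBelow : ∀ {n} → ℕ → Graph n → Set
EntriesBelow B Δ = ∀ i j → Δ i j ≤ B

entriesBelow-mono : ∀ {n} {B C} {Δ : Graph n} → B ≤ C → EntriesBelow B Δ → EntriesBelow C Δ
entriesBelow-mono B≤C below i j = ≤-trans (below i j) B≤C

graph-bound : ∀ {n} (Δ : Graph n) → ∃ λ B → EntriesBelow B Δ
graph-bound Δ with finite-bound (λ i → proj₁ (finite-bound (Δ i)))
... | B , rows≤B = B , λ i j → ≤-trans (proj₂ (finite-bound (Δ i)) j) (rows≤B i)

list-bound : ∀ {n} (L : List (Graph n)) → ∃ λ B → All (EntriesBelow B) L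
list-bound []      = 0 , []
list-bound (Δ ∷ L) with graph-bound Δ | list-bound L
... | B , Δ-below | C , L-below =
  B ⊔ C , entriesBelow-mono (m≤m⊔n B C) Δ-below
        ∷ All.map (entriesBelow-mono (m≤n⊔m B C)) L-below

iso-entriesBelow : ∀ {n} {B} {G Δ : Graph n} → EntriesBelow B Δ → Iso G Δ → EntriesBelow B G
iso-entriesBelow Δ-below (σ , _ , _ , _ , preserves) u v =
  subst (_≤ _) (preserves u v) (Δ-below (σ u) (σ v))

mutationFinite⇒bounded : ∀ {n} {Γ : Graph n} → MutationFinite Γ → Bounded Γ
mutationFinite⇒bounded (L , classes) with list-bound L
... | B , L-below = B , λ ks → All.lookupWith iso-entriesBelow L-below (classes ks)

-- Pointwise equality of graphs; without function extensionality, the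
-- duality below can only be stated pointwise.
_≐_ : ∀ {n} → Graph n → Graph n → Set
Γ ≐ Δ = ∀ i j → Γ i j ≡ Δ i j

mutate-cong : ∀ {n} (k : Fin n) {Γ Δ : Graph n} → Γ ≐ Δ → mutate k Γ ≐ mutate k Δ
mutate-cong k Γ≐Δ i j with i ≟ k | j ≟ k
... | yes _ | _     = Γ≐Δ j i
... | no _  | yes _ = Γ≐Δ j i
... | no _  | no _  =
  cong₂ _∸_ (cong₂ _+_ (Γ≐Δ i j) (cong₂ _*_ (Γ≐Δ i k) (Γ≐Δ k j)))
            (cong₂ _+_ (Γ≐Δ j i) (cong₂ _*_ (Γ≐Δ j k) (Γ≐Δ k i)))

mutateSeq-cong : ∀ {n} (ks : List (Fin n)) {Γ Δ : Graph n} → Γ ≐ Δ → mutateSeq ks Γ ≐ mutateSeq ks Δ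
mutateSeq-cong []       Γ≐Δ = Γ≐Δ
mutateSeq-cong (k ∷ ks) Γ≐Δ = mutateSeq-cong ks (mutate-cong k Γ≐Δ)

opposite : ∀ {n} → Graph n → Graph n
opposite Γ i j = Γ j i

opposite-isGraph : ∀ {n} {Γ : Graph n} → IsGraph Γ → IsGraph (opposite Γ)
opposite-isGraph (loopless , no-2-cycles) = loopless , λ i j → no-2-cycles j i

mutate-opposite : ∀ {n} (k : Fin n) (Γ : Graph n) → mutate k (opposite Γ) ≐ opposite (mutate k Γ)
mutate-opposite k Γ i j with i ≟ k | j ≟ k
... | yes _ | yes _ = refl
... | yes _ | no _  = refl
... | no _  | yes _ = refl
... | no _  | no _  =
  cong₂ (λ a b → (Γ j i + a) ∸ (Γ i j + b)) (*-comm (Γ k i) (Γ j k)) (*-comm (Γ k j) (Γ i k))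

mutateSeq-opposite : ∀ {n} (ks : List (Fin n)) (Γ : Graph n) →
                     mutateSeq ks (opposite Γ) ≐ opposite (mutateSeq ks Γ)
mutateSeq-opposite []       Γ i j = refl
mutateSeq-opposite (k ∷ ks) Γ i j =
  trans (mutateSeq-cong ks (mutate-opposite k Γ) i j) (mutateSeq-opposite ks (mutate k Γ) i j)

bounded-opposite : ∀ {n} {Γ : Graph n} → Bounded Γ → Bounded (opposite Γ)
bounded-opposite {Γ = Γ} (B , bound) =
  B , λ ks u v → subst (_≤ B) (sym (mutateSeq-opposite ks Γ u v)) (bound ks v u)

mutate-at : ∀ {n} (k : Fin n) (Γ : Graph n) i j → i ≡ k ⊎ j ≡ k → mutate k Γ i j ≡ Γ j i
mutate-at k Γ i j at-k with i ≟ k | j ≟ k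
... | yes _   | _       = refl
... | no _    | yes _   = refl
... | no i≢k  | no j≢k  = ⊥-elim ([ i≢k , j≢k ] at-k)

mutate-away : ∀ {n} (k : Fin n) (Γ : Graph n) i j → i ≢ k → j ≢ k →
              mutate k Γ i j ≡ (Γ i j + Γ i k * Γ k j) ∸ (Γ j i + Γ j k * Γ k i)
mutate-away k Γ i j i≢k j≢k with i ≟ k | j ≟ k
... | yes i≡k | _       = ⊥-elim (i≢k i≡k)
... | no _    | yes j≡k = ⊥-elim (j≢k j≡k)
... | no _    | no _    = refl

record Pumping {n} (Γ : Graph n) (y k j : Fin n) : Set where
  field
    double  : Γ k j ≡ 2
    k↛y     : Γ k y ≡ 0
    deficit : Γ j y < Γ y k + Γ y j
    k≢j     : k ≢ j
    y≢k     : y ≢ k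
    y≢j     : y ≢ j

-- The arithmetic behind one pumping step, with a = #(y → k), b = #(y → j)
-- and c = #(j → y):  after mutation y receives b + 2a - c > a arrows to j,
-- and the arrows j → y cancel completely.
double-sum : ∀ a b → a + (a + b) ≡ b + a * 2
double-sum = solve-∀

pump-grows : ∀ a b c → c < a + b → a < (b + a * 2) ∸ c
pump-grows a b c c<a+b = m+n≤o⇒m≤o∸n (suc a) (begin
  suc a + c    ≡⟨ sym (+-suc a c) ⟩
  a + suc c    ≤⟨ +-monoʳ-≤ a c<a+b ⟩
  a + (a + b)  ≡⟨ double-sum a b ⟩
  b + a * 2    ∎)
  where open ≤-Reasoning

pump-cancels : ∀ a b c → c < a + b → c ∸ (b + a * 2) ≡ 0
pump-cancels a b c c<a+b = m≤n⇒m∸n≡0 (begin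
  c            ≤⟨ <⇒≤ c<a+b ⟩
  a + b        ≤⟨ m≤n+m (a + b) a ⟩
  a + (a + b)  ≡⟨ double-sum a b ⟩
  b + a * 2    ∎)
  where open ≤-Reasoning

pumping-step : ∀ {n} {Γ : Graph n} {y k j} → Pumping Γ y k j →
               Pumping (mutate k Γ) y j k × Γ y k < mutate k Γ y j
pumping-step {Γ = Γ} {y} {k} {j} p = record
  { double  = trans (mutate-at k Γ j k (inj₂ refl)) double
  ; k↛y     = trans j→y (pump-cancels (Γ y k) (Γ y j) (Γ j y) deficit)
  ; deficit = subst (_< mutate k Γ y j + mutate k Γ y k)
                    (sym (mutate-at k Γ k y (inj₁ refl))) grows′
  ; k≢j     = j≢k
  ; y≢k     = y≢j
  ; y≢j     = y≢k
  } , grows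
  where
  open Pumping p
  j≢k : j ≢ k
  j≢k = ≢-sym k≢j
  -- there is no path j → k → y, so j → y gains no composite arrows
  no-composite : Γ j y + Γ j k * Γ k y ≡ Γ j y
  no-composite = begin
    Γ j y + Γ j k * Γ k y  ≡⟨ cong (λ e → Γ j y + Γ j k * e) k↛y ⟩
    Γ j y + Γ j k * 0      ≡⟨ cong (Γ j y +_) (*-zeroʳ (Γ j k)) ⟩
    Γ j y + 0              ≡⟨ +-identityʳ (Γ j y) ⟩
    Γ j y                  ∎
    where open ≡-Reasoning
  y→j : mutate k Γ y j ≡ (Γ y j + Γ y k * 2) ∸ Γ j y
  y→j = trans (mutate-away k Γ y j y≢k j≢k)
              (cong₂ (λ d e → (Γ y j + Γ y k * d) ∸ e) double no-composite)
  j→y : mutate k Γ j y ≡ Γ j y ∸ (Γ y j + Γ y k * 2)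
  j→y = trans (mutate-away k Γ j y j≢k y≢k)
              (cong₂ (λ d e → d ∸ (Γ y j + Γ y k * e)) no-composite double)
  grows : Γ y k < mutate k Γ y j
  grows = subst (Γ y k <_) (sym y→j) (pump-grows (Γ y k) (Γ y j) (Γ j y) deficit)
  grows′ : Γ y k < mutate k Γ y j + mutate k Γ y k
  grows′ = <-≤-trans grows (m≤m+n _ _)

pumping-bound : ∀ {n} {Γ : Graph n} {y k j} {B} m → BoundedBy B Γ → Pumping Γ y k j →
                m + Γ y k ≤ B
pumping-bound {y = y} {k} zero    bound p = bound [] y k
pumping-bound {Γ = Γ} {y} {k} {j} {B} (suc m) bound p with pumping-step p
... | p′ , grows = begin
  suc m + Γ y k       ≡⟨ sym (+-suc m (Γ y k)) ⟩
  m + suc (Γ y k)     ≤⟨ +-monoʳ-≤ m grows ⟩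
  m + mutate k Γ y j  ≤⟨ pumping-bound m (boundedBy-mutate k bound) p′ ⟩
  B                   ∎
  where open ≤-Reasoning

pumping⇒unbounded : ∀ {n} {Γ : Graph n} {y k j} → Pumping Γ y k j → ¬ Bounded Γ
pumping⇒unbounded p (B , bound) = <-irrefl refl (m+n≤o⇒m≤o (suc B) (pumping-bound (suc B) bound p))

one-way : ∀ {n} {Γ : Graph n} → IsGraph Γ → ∀ i j → 1 ≤ Γ i j → Γ j i ≡ 0
one-way (_ , no-2-cycles) i j i→j with no-2-cycles i j
... | inj₁ none = ⊥-elim (<⇒≢ i→j (sym none))
... | inj₂ none = none

record Triangle {n} (Γ : Graph n) (y k s t : Fin n) : Set where
  field
    k⇉s : Γ k s ≡ 2
    s⇉t : Γ s t ≡ 2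
    t⇉k : Γ t k ≡ 2
    k≢s : k ≢ s
    s≢t : s ≢ t
    t≢k : t ≢ k
    y≢k : y ≢ k
    y≢s : y ≢ s
    y≢t : y ≢ t

rotate : ∀ {n} {Γ : Graph n} {y k s t} → Triangle Γ y k s t → Triangle Γ y s t k
rotate tri = record
  { k⇉s = s⇉t ; s⇉t = t⇉k ; t⇉k = k⇉s
  ; k≢s = s≢t ; s≢t = t≢k ; t≢k = k≢s
  ; y≢k = y≢s ; y≢s = y≢t ; y≢t = y≢k }
  where open Triangle tri

reverse : ∀ {n} {Γ : Graph n} {y k s t} → Triangle Γ y k s t → Triangle (opposite Γ) y k t s
reverse tri = record
  { k⇉s = t⇉k ; s⇉t = s⇉t ; t⇉k = k⇉s
  ; k≢s = ≢-sym t≢k ; s≢t = ≢-sym s≢t ; t≢k = ≢-sym k≢s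
  ; y≢k = y≢k ; y≢s = y≢t ; y≢t = y≢s }
  where open Triangle tri

-- If y has an arrow into a corner k of the triangle, there is a pumping
-- configuration: on k ⇉ s, or else (then s → y) on t ⇉ k when y → t,
-- or else, in the opposite graph, on the reversed double arrow t ⇉ s.
triangle-source : ∀ {n} {Γ : Graph n} {y k s t} → IsGraph Γ → Triangle Γ y k s t →
                  1 ≤ Γ y k → ¬ Bounded Γ
triangle-source {Γ = Γ} {y} {k} {s} {t} isGraph tri y→k with Γ s y <? Γ y k + Γ y s
... | yes deficit = pumping⇒unbounded {j = s} (record
  { double = k⇉s ; k↛y = one-way isGraph y k y→k ; deficit = deficit
  ; k≢j = k≢s ; y≢k = y≢k ; y≢j = y≢s })
  where open Triangle tri
... | no no-deficit = via-t
  where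
  open Triangle tri
  s→y : 1 ≤ Γ s y
  s→y = ≤-trans y→k (≤-trans (m≤m+n (Γ y k) (Γ y s)) (≮⇒≥ no-deficit))
  via-t : ¬ Bounded Γ
  via-t with Γ y t in y→t
  ... | zero = λ bounded → pumping⇒unbounded {Γ = opposite Γ} {j = s} (record
    { double = s⇉t ; k↛y = y→t
    ; deficit = subst (_< Γ t y + Γ s y) (sym (one-way isGraph s y s→y)) (≤-trans s→y (m≤n+m _ _))
    ; k≢j = ≢-sym s≢t ; y≢k = y≢t ; y≢j = y≢s }) (bounded-opposite bounded)
  ... | suc _ = pumping⇒unbounded {j = k} (record
    { double = t⇉k ; k↛y = one-way isGraph y t y→t′
    ; deficit = subst (_< Γ y t + Γ y k) (sym (one-way isGraph y k y→k)) (≤-trans y→t′ (m≤m+n _ _))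
    ; k≢j = t≢k ; y≢k = y≢t ; y≢j = y≢k })
    where
    y→t′ : 1 ≤ Γ y t
    y→t′ = subst (1 ≤_) (sym y→t) (s≤s z≤n)

-- Any vertex outside a Z₃-triangle that is adjacent to it makes Γ unbounded;
-- arrows out of the triangle reduce to arrows into it in the opposite graph.
triangle-neighbour : ∀ {n} {Γ : Graph n} {y k s t} → IsGraph Γ → Triangle Γ y k s t →
                     Adjacent Γ k y → ¬ Bounded Γ
triangle-neighbour isGraph tri (inj₁ k→y) bounded =
  triangle-source (opposite-isGraph isGraph) (reverse tri) k→y (bounded-opposite bounded)
triangle-neighbour isGraph tri (inj₂ y→k) = triangle-source isGraph tri y→k

InImage : ∀ {m n} → (Fin m → Fin n) → Fin n → Set
InImage f z = ∃ λ a → f a ≡ z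

inImage? : ∀ {m n} (f : Fin m → Fin n) → Decidable (InImage f)
inImage? f z = any? (λ a → f a ≟ z)

missed-vertex : ∀ {m n} → m < n → (f : Fin m → Fin n) → ∃ λ z → ¬ InImage f z
missed-vertex {m} {n} m<n f with all? (inImage? f)
... | no not-onto = ¬∀⟶∃¬ n (InImage f) (inImage? f) not-onto
... | yes onto = ⊥-elim (<⇒≱ m<n (injective⇒≤ section-injective))
  where
  section : Fin n → Fin m
  section z = proj₁ (onto z)
  section-injective : Injective _≡_ _≡_ section
  section-injective {z} {w} same =
    trans (sym (proj₂ (onto z))) (trans (cong f same) (proj₂ (onto w)))

crossing-edge : ∀ {n} {Γ : Graph n} {P : Fin n → Set} → Decidable P → ∀ {i z} →
                Reach Γ i z → P i → ¬ P z → ∃ λ x → ∃ λ y → P x × ¬ P y × Adjacent Γ x y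
crossing-edge P? here            Pi ¬Pz = ⊥-elim (¬Pz Pi)
crossing-edge P? (step {j = j} i~j path) Pi ¬Pz with P? j
... | yes Pj = crossing-edge P? path Pj ¬Pz
... | no ¬Pj = _ , j , Pi , ¬Pj , i~j

z3-triangle : ∀ {n} {Γ : Graph n} {f : Fin 3 → Fin n} {y} → Injective _≡_ _≡_ f →
              (∀ a b → Γ (f a) (f b) ≡ Z3 a b) → ¬ InImage f y →
              ∀ a → ∃ λ s → ∃ λ t → Triangle Γ y (f a) s t
z3-triangle {f = f} f-injective f-Z3 y∉f = corner
  where
  distinct : ∀ {a b} → a ≢ b → f a ≢ f b
  distinct a≢b fa≡fb = a≢b (f-injective fa≡fb)
  outside : ∀ a → _ ≢ f a
  outside a y≡fa = y∉f (a , sym y≡fa)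
  x₁ x₂ x₃ : Fin 3
  x₁ = Fin.zero
  x₂ = Fin.suc Fin.zero
  x₃ = Fin.suc (Fin.suc Fin.zero)
  base : Triangle _ _ (f x₁) (f x₂) (f x₃)
  base = record
    { k⇉s = f-Z3 x₁ x₂ ; s⇉t = f-Z3 x₂ x₃ ; t⇉k = f-Z3 x₃ x₁
    ; k≢s = distinct (λ ()) ; s≢t = distinct (λ ()) ; t≢k = distinct (λ ())
    ; y≢k = outside x₁ ; y≢s = outside x₂ ; y≢t = outside x₃ }
  corner : ∀ a → ∃ λ s → ∃ λ t → Triangle _ _ (f a) s t
  corner Fin.zero                     = _ , _ , base
  corner (Fin.suc Fin.zero)           = _ , _ , rotate base
  corner (Fin.suc (Fin.suc Fin.zero)) = _ , _ , rotate (rotate base)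

lemma7 : (n : ℕ) → 4 ≤ n → (Γ : Graph n) → IsGraph Γ → Connected Γ →
    MutationFinite Γ → ¬ ContainsZ3 Γ
lemma7 n 4≤n Γ isGraph connected finite (f , f-injective , f-Z3)
  with missed-vertex 4≤n f
... | z , z∉f
  with crossing-edge (inImage? f) (connected (f Fin.zero) z) (Fin.zero , refl) z∉f
... | _ , y , (a , refl) , y∉f , fa~y
  with z3-triangle f-injective f-Z3 y∉f a
... | _ , _ , triangle =
  triangle-neighbour isGraph triangle fa~y (mutationFinite⇒bounded finite)
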